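{- Let $\ell\neq 2$ be a prime and let $A$ be a finite subgroup of $\mathrm{SL}_2(\overline{\mathbb{F}}_\ell)$ with $|A|\neq 1$. Then $\sum_{a\in A} a=0$ in the matrix ring $M_2(\overline{\mathbb{F}}_\ell)$. -}

module Defs where

open import Level using (Level; _⊔_)
open import Data.Nat using (ℕ; zero; suc; _≥_)
open import Data.List using (List; []; _∷_; _++_; [_]; map; length)
open import Data.List.Relation.Unary.Any using (Any)
open import Data.List.Relation.Unary.All using (All)
open import Data.List.Relation.Unary.AllPairs using (AllPairs)
open import Data.Product using (Σ; ∃; _×_)
open import Relation.Nullary using (¬_)
open import Algebra.Bundles using (CommutativeRing)

module _ {c ℓ : Level} (R : CommutativeRing c ℓ) where
  open CommutativeRing R

  natCast : ℕ → Carrier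
  natCast zero    = 0#
  natCast (suc n) = 1# + natCast n

  -- polynomial given by coefficient list (constant term first), Horner evaluation
  eval : List Carrier → Carrier → Carrier
  eval []       x = 0#
  eval (a ∷ as) x = a + x * eval as x

  record IsField : Set (c ⊔ ℓ) where
    field
      0≉1     : ¬ (0# ≈ 1#)
      inverse : ∀ x → ¬ (x ≈ 0#) → ∃ λ y → x * y ≈ 1#

  HasChar : ℕ → Set ℓ
  HasChar p = natCast p ≈ 0#

  -- every monic polynomial  a₀ + a₁X + … + a_{n-1}X^{n-1} + Xⁿ  of degree n ≥ 1 has a root
  IsAlgClosed : Set (c ⊔ ℓ)
  IsAlgClosed = ∀ (as : List Carrier) → length as ≥ 1 →
                ∃ λ x → eval (as ++ [ 1# ]) x ≈ 0#

  -- every element is a root of a monic polynomial with coefficients in the prime subfield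
  IsAlgebraicOverPrimeField : Set (c ⊔ ℓ)
  IsAlgebraicOverPrimeField =
    ∀ x → ∃ λ (ns : List ℕ) → eval (map natCast ns ++ [ 1# ]) x ≈ 0#

  -- R is an algebraic closure of 𝔽_p  (unique up to isomorphism)
  record IsAlgClosureOfFp (p : ℕ) : Set (c ⊔ ℓ) where
    field
      isField   : IsField
      char      : HasChar p
      algClosed : IsAlgClosed
      algebraic : IsAlgebraicOverPrimeField

  record M2 : Set c where
    constructor mat
    field
      e11 e12 e21 e22 : Carrier

  open M2

  _≈M_ : M2 → M2 → Set ℓ
  A ≈M B = (e11 A ≈ e11 B) × (e12 A ≈ e12 B) × (e21 A ≈ e21 B) × (e22 A ≈ e22 B)

  _+M_ : M2 → M2 → M2
  A +M B = mat (e11 A + e11 B) (e12 A + e12 B) (e21 A + e21 B) (e22 A + e22 B)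

  _*M_ : M2 → M2 → M2
  A *M B = mat (e11 A * e11 B + e12 A * e21 B) (e11 A * e12 B + e12 A * e22 B)
               (e21 A * e11 B + e22 A * e21 B) (e21 A * e12 B + e22 A * e22 B)

  0M : M2
  0M = mat 0# 0# 0# 0#

  1M : M2
  1M = mat 1# 0# 0# 1#

  det : M2 → Carrier
  det A = e11 A * e22 A - e12 A * e21 A

  -- inverse of a determinant-one matrix (adjugate)
  invSL : M2 → M2
  invSL A = mat (e22 A) (- e12 A) (- e21 A) (e11 A)

  sumM : List M2 → M2
  sumM []       = 0M
  sumM (A ∷ As) = A +M sumM As

  _∈M_ : M2 → List M2 → Set (c ⊔ ℓ)
  A ∈M As = Any (λ B → A ≈M B) As

  -- a finite subgroup of SL₂(R), given by the duplicate-free list of its elements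
  record IsFiniteSubgroupSL2 (As : List M2) : Set (c ⊔ ℓ) where
    field
      distinct : AllPairs (λ A B → ¬ (A ≈M B)) As
      inSL2    : All (λ A → det A ≈ 1#) As
      hasOne   : 1M ∈M As
      mulClosed : ∀ A B → A ∈M As → B ∈M As → (A *M B) ∈M As
      invClosed : ∀ A → A ∈M As → invSL A ∈M As

-- S = Σ_{g ∈ G} g is fixed by the adjugate g ↦ g⁻¹ and by left multiplication with each g ∈ G, since both permute G.
-- Adjugate invariance gives -x = x for the off-diagonal entries, which therefore vanish as 2 is invertible, and equal
-- diagonal entries: S = s I. Then s g = g S = S = s I for every g ∈ G, so two distinct elements g, h give s (g - h) = 0,
-- whence s = 0 in the field. Constructively, g ≠ h only says that not all entries of g - h vanish; s = 0 is still
-- obtained because every y algebraic over 𝔽_p satisfies y^m (1 + y z) = 0 for some m and z.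

module Submission where

open import Defs
open import Level using (Level)
open import Data.Nat using (ℕ)
open import Data.Nat.Primality using (Prime)
open import Data.List using (List; length)
open import Relation.Binary.PropositionalEquality using (_≢_)
open import Algebra.Bundles using (CommutativeRing)

open import Algebra.Bundles using (Monoid; CommutativeMonoid)
import Data.Nat as ℕ
open import Data.Nat.Properties using (suc-injective; ≤-antisym)
open import Data.Nat.Divisibility using (_∣_; _∣?_; divides; ∣⇒≤)
open import Data.Nat.Coprimality using (Coprime; coprime-Bézout)
open import Data.Nat.GCD using (module Bézout)
open import Data.Nat.Primality using (prime⇒irreducible; prime⇒nonTrivial)
open import Data.List using ([]; _∷_; _++_; [_]; map; foldr)
open import Data.List.Properties using (length-map)
open import Data.List.Relation.Unary.All using (All; []; _∷_)
import Data.List.Relation.Unary.All as All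
import Data.List.Relation.Unary.All.Properties as All
open import Data.List.Relation.Unary.AllPairs using (AllPairs; []; _∷_)
import Data.List.Relation.Unary.AllPairs as AllPairs
open import Data.List.Relation.Unary.Any using (here; there)
import Data.List.Relation.Unary.Unique.Setoid.Properties as Unique
open import Data.Product using (Σ; ∃; _,_; proj₁; proj₂)
open import Data.Sum using (_⊎_; inj₁; inj₂)
open import Relation.Binary.Bundles using (Setoid)
open import Relation.Binary.PropositionalEquality using (_≡_)
import Relation.Binary.PropositionalEquality as ≡
open import Relation.Nullary using (¬_; yes; no; contradiction)

module _ {a ℓ} (S : Setoid a ℓ) where
  open Setoid S
  open import Data.List.Membership.Setoid S using (_∈_)
  open import Data.List.Membership.Setoid.Properties using (∈-∃++)
  open import Data.List.Relation.Unary.Unique.Setoid S using (Unique)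
  open import Data.List.Relation.Binary.Permutation.Setoid S
  open import Data.List.Relation.Binary.Permutation.Setoid.Properties S
    using (shift; ∈-resp-↭; xs↭ys⇒|xs|≡|ys|)

  ∈⇒↭∷ : ∀ {x ys} → x ∈ ys → ∃ λ zs → ys ↭ x ∷ zs
  ∈⇒↭∷ x∈ys with hs , ts , _ , x≈w , ys≋ ← ∈-∃++ S x∈ys =
    hs ++ ts , ↭-trans (↭-reflexive-≋ ys≋) (shift (sym x≈w) hs ts)

  unique∧⊆⇒↭ : ∀ {xs ys} → Unique xs → length xs ≡ length ys → All (_∈ ys) xs → xs ↭ ys
  unique∧⊆⇒↭ {[]} {[]} _ _ _ = ↭-refl
  unique∧⊆⇒↭ {x ∷ xs} {ys} (x≉xs ∷ xs!) |x∷xs|≡|ys| (x∈ys ∷ xs⊆ys) =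
    ↭-sym (↭-trans ys↭x∷zs (↭-prep x (↭-sym (unique∧⊆⇒↭ xs! |xs|≡|zs| xs⊆zs))))
    where
    zs = proj₁ (∈⇒↭∷ x∈ys)
    ys↭x∷zs = proj₂ (∈⇒↭∷ x∈ys)

    |xs|≡|zs| : length xs ≡ length zs
    |xs|≡|zs| = suc-injective (≡.trans |x∷xs|≡|ys| (xs↭ys⇒|xs|≡|ys| ys↭x∷zs))

    ∈zs : ∀ {y} → ¬ x ≈ y → y ∈ ys → y ∈ zs
    ∈zs x≉y y∈ys with ∈-resp-↭ ys↭x∷zs y∈ys
    ... | here y≈x   = contradiction (sym y≈x) x≉y
    ... | there y∈zs = y∈zs

    xs⊆zs : All (_∈ zs) xs
    xs⊆zs = All.zipWith (λ (x≉y , y∈ys) → ∈zs x≉y y∈ys) (x≉xs , xs⊆ys)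

module _ {c ℓ} (M : Monoid c ℓ) where
  open Monoid M
  open import Relation.Binary.Reasoning.Setoid setoid

  foldr-map-homo : (f : Carrier → Carrier) → f ε ≈ ε → (∀ x y → f (x ∙ y) ≈ f x ∙ f y) →
                   ∀ xs → foldr _∙_ ε (map f xs) ≈ f (foldr _∙_ ε xs)
  foldr-map-homo f f-ε f-∙ []       = sym f-ε
  foldr-map-homo f f-ε f-∙ (x ∷ xs) = begin
    f x ∙ foldr _∙_ ε (map f xs) ≈⟨ ∙-congˡ (foldr-map-homo f f-ε f-∙ xs) ⟩
    f x ∙ f (foldr _∙_ ε xs)     ≈⟨ f-∙ x (foldr _∙_ ε xs) ⟨
    f (x ∙ foldr _∙_ ε xs)       ∎

module _ {c ℓ} (M : CommutativeMonoid c ℓ) where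
  open CommutativeMonoid M
  open import Data.List.Membership.Setoid setoid using (_∈_)
  open import Data.List.Relation.Unary.Unique.Setoid setoid using (Unique)
  open import Data.List.Relation.Binary.Permutation.Setoid.Properties setoid
    using (foldr-commMonoid)

  foldr-map-permutation : (f : Carrier → Carrier) → (∀ {x y} → f x ≈ f y → x ≈ y) →
                          ∀ {xs} → Unique xs → (∀ {x} → x ∈ xs → f x ∈ xs) →
                          foldr _∙_ ε (map f xs) ≈ foldr _∙_ ε xs
  foldr-map-permutation f f-injective {xs} xs! f-closed = foldr-commMonoid isCommutativeMonoid
    (unique∧⊆⇒↭ setoid (Unique.map⁺ setoid setoid f-injective xs!) (length-map f xs)
                        (All.map⁺ (All.tabulateₛ setoid f-closed)))

All-¬¬ : ∀ {a p} {A : Set a} {P : A → Set p} {xs} → All (λ x → ¬ ¬ P x) xs → ¬ ¬ All P xs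
All-¬¬ []             ¬all = ¬all []
All-¬¬ (¬¬px ∷ ¬¬pxs) ¬all = ¬¬px (λ px → All-¬¬ ¬¬pxs (λ pxs → ¬all (px ∷ pxs)))

prime∤⇒coprime : ∀ {p n} → Prime p → ¬ p ∣ n → Coprime p n
prime∤⇒coprime p-prime p∤n (d∣p , d∣n) with prime⇒irreducible p-prime d∣p
... | inj₁ d≡1 = d≡1
... | inj₂ ≡.refl = contradiction d∣n p∤n

prime≢2⇒∤2 : ∀ {p} → Prime p → p ≢ 2 → ¬ p ∣ 2
prime≢2⇒∤2 {p} p-prime p≢2 p∣2 =
  p≢2 (≤-antisym (∣⇒≤ p∣2) (ℕ.nonTrivial⇒n>1 p {{prime⇒nonTrivial p-prime}}))

module Scalars {c ℓ} (K : CommutativeRing c ℓ) where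
  open CommutativeRing K
  open import Algebra.Properties.Ring ring
    using (-‿distribʳ-*; +-inverseˡ-unique; x[y-z]≈xy-xz; x∙y⁻¹≈ε⇒x≈y; x≈y⇒x∙y⁻¹≈ε)
  open import Algebra.Properties.CommutativeSemigroup *-commutativeSemigroup using (x∙yz≈y∙xz)
  open import Algebra.Properties.Semiring.Mult semiring using (×1-homo-*) renaming (_×_ to _·_)
  open import Algebra.Properties.Semiring.Exp semiring using (_^_) public
  open import Algebra.Solver.Ring.NaturalCoefficients.Default commutativeSemiring
  open import Relation.Binary.Reasoning.Setoid setoid

  IsUnit : Carrier → Set (c Level.⊔ ℓ)
  IsUnit x = ∃ λ y → x * y ≈ 1#

  -- The form x ^ m ≈ x ^ (m + 1) * y of strong π-regularity, with y = - z so that no subtraction occurs.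
  StronglyπRegular : Carrier → Set (c Level.⊔ ℓ)
  StronglyπRegular x = Σ ℕ λ m → Σ Carrier λ z → x ^ m * (1# + x * z) ≈ 0#

  natCast≡·1# : ∀ n → natCast K n ≡ n · 1#
  natCast≡·1# ℕ.zero    = ≡.refl
  natCast≡·1# (ℕ.suc n) = ≡.cong (1# +_) (natCast≡·1# n)

  natCast-* : ∀ m n → natCast K (m ℕ.* n) ≈ natCast K m * natCast K n
  natCast-* m n rewrite natCast≡·1# (m ℕ.* n) | natCast≡·1# m | natCast≡·1# n = ×1-homo-* m n

  module Characteristic {p} (char-p : HasChar K p) where

    natCast-multiple≈0 : ∀ q → natCast K (q ℕ.* p) ≈ 0#
    natCast-multiple≈0 q = begin
      natCast K (q ℕ.* p)        ≈⟨ natCast-* q p ⟩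
      natCast K q * natCast K p  ≈⟨ *-congˡ char-p ⟩
      natCast K q * 0#           ≈⟨ zeroʳ _ ⟩
      0#                         ∎

    coprime⇒natCast-unit : ∀ {n} → Coprime p n → IsUnit (natCast K n)
    coprime⇒natCast-unit {n} p⊥n with coprime-Bézout p⊥n
    ... | Bézout.+- x y 1+yn≡xp = - natCast K y , (begin
      natCast K n * - natCast K y   ≈⟨ -‿distribʳ-* _ _ ⟨
      - (natCast K n * natCast K y) ≈⟨ -‿cong (*-comm _ _) ⟩
      - (natCast K y * natCast K n) ≈⟨ +-inverseˡ-unique 1# _ 1+yn≈0 ⟨
      1#                            ∎)
      where
      1+yn≈0 : 1# + natCast K y * natCast K n ≈ 0#
      1+yn≈0 = begin
        1# + natCast K y * natCast K n ≈⟨ +-congˡ (natCast-* y n) ⟨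
        natCast K (1 ℕ.+ y ℕ.* n)      ≡⟨ ≡.cong (natCast K) 1+yn≡xp ⟩
        natCast K (x ℕ.* p)            ≈⟨ natCast-multiple≈0 x ⟩
        0#                             ∎
    ... | Bézout.-+ x y 1+xp≡yn = natCast K y , (begin
      natCast K n * natCast K y ≈⟨ *-comm _ _ ⟩
      natCast K y * natCast K n ≈⟨ natCast-* y n ⟨
      natCast K (y ℕ.* n)       ≡⟨ ≡.cong (natCast K) 1+xp≡yn ⟨
      1# + natCast K (x ℕ.* p)  ≈⟨ +-congˡ (natCast-multiple≈0 x) ⟩
      1# + 0#                   ≈⟨ +-identityʳ 1# ⟩
      1#                        ∎)

    module _ (p-prime : Prime p) where

      natCast-zero-or-unit : ∀ n → natCast K n ≈ 0# ⊎ IsUnit (natCast K n)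
      natCast-zero-or-unit n with p ∣? n
      ... | yes (divides q ≡.refl) = inj₁ (natCast-multiple≈0 q)
      ... | no p∤n               = inj₂ (coprime⇒natCast-unit (prime∤⇒coprime p-prime p∤n))

      -- The coefficients of a polynomial over the prime field are zero or units, so a root x factors as
      -- x ^ k * (unit + x * q(x)) ≈ 0.
      root⇒stronglyπRegular : ∀ {x} ns k → x ^ k * eval K (map (natCast K) ns ++ [ 1# ]) x ≈ 0# →
                              StronglyπRegular x
      root⇒stronglyπRegular []       k root = k , 0# , root
      root⇒stronglyπRegular {x} (n ∷ ns) k root with natCast-zero-or-unit n
      ... | inj₁ n≈0 = root⇒stronglyπRegular ns (ℕ.suc k) (begin
        x * x ^ k * e               ≈⟨ solve 3 (λ x xᵏ e → x :* xᵏ :* e := xᵏ :* (x :* e)) refl x (x ^ k) e ⟩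
        x ^ k * (x * e)             ≈⟨ *-congˡ (+-identityˡ _) ⟨
        x ^ k * (0# + x * e)        ≈⟨ *-congˡ (+-congʳ n≈0) ⟨
        x ^ k * (natCast K n + x * e) ≈⟨ root ⟩
        0#                          ∎)
        where e = eval K (map (natCast K) ns ++ [ 1# ]) x
      ... | inj₂ (u , un≈1) = k , u * e , (begin
        x ^ k * (1# + x * (u * e))              ≈⟨ *-congˡ (+-congʳ un≈1) ⟨
        x ^ k * (natCast K n * u + x * (u * e)) ≈⟨ solve 5 (λ xᵏ u n x e →
                                                      xᵏ :* (n :* u :+ x :* (u :* e)) := u :* (xᵏ :* (n :+ x :* e)))
                                                    refl (x ^ k) u (natCast K n) x e ⟩
        u * (x ^ k * (natCast K n + x * e))     ≈⟨ *-congˡ root ⟩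
        u * 0#                                  ≈⟨ zeroʳ u ⟩
        0#                                      ∎)
        where e = eval K (map (natCast K) ns ++ [ 1# ]) x

      algebraic⇒stronglyπRegular : IsAlgebraicOverPrimeField K → ∀ x → StronglyπRegular x
      algebraic⇒stronglyπRegular algebraic x with ns , root ← algebraic x =
        root⇒stronglyπRegular ns 0 (trans (*-identityˡ _) root)

      -x≈x⇒x≈0 : p ≢ 2 → ∀ {x} → - x ≈ x → x ≈ 0#
      -x≈x⇒x≈0 p≢2 {x} -x≈x
        with u , 2u≈1 ← coprime⇒natCast-unit (prime∤⇒coprime p-prime (prime≢2⇒∤2 p-prime p≢2)) = begin
        x                               ≈⟨ *-identityˡ x ⟨
        1# * x                          ≈⟨ *-congʳ 2u≈1 ⟨
        (1# + (1# + 0#)) * u * x        ≈⟨ solve 2 (λ u x → (con 1 :+ (con 1 :+ con 0)) :* u :* x := u :* (x :+ x))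
                                                   refl u x ⟩
        u * (x + x)                     ≈⟨ *-congˡ (+-congʳ -x≈x) ⟨
        u * (- x + x)                   ≈⟨ *-congˡ (-‿inverseˡ x) ⟩
        u * 0#                          ≈⟨ zeroʳ u ⟩
        0#                              ∎

  module _ (K-field : IsField K) where
    open IsField K-field

    unit-pow≉0 : ∀ {x} → IsUnit x → ∀ m → ¬ x ^ m ≈ 0#
    unit-pow≉0 _ ℕ.zero 1≈0 = 0≉1 (sym 1≈0)
    unit-pow≉0 {x} (w , xw≈1) (ℕ.suc m) xxᵐ≈0 = unit-pow≉0 (w , xw≈1) m (begin
      x ^ m            ≈⟨ *-identityˡ _ ⟨
      1# * x ^ m       ≈⟨ *-congʳ xw≈1 ⟨
      x * w * x ^ m    ≈⟨ solve 3 (λ x w xᵐ → x :* w :* xᵐ := w :* (x :* xᵐ)) refl x w (x ^ m) ⟩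
      w * (x * x ^ m)  ≈⟨ *-congˡ xxᵐ≈0 ⟩
      w * 0#           ≈⟨ zeroʳ w ⟩
      0#               ∎)

    pow≈0⇒¬¬≈0 : ∀ {x} m → x ^ m ≈ 0# → ¬ ¬ x ≈ 0#
    pow≈0⇒¬¬≈0 m xᵐ≈0 x≉0 = unit-pow≉0 (inverse _ x≉0) m xᵐ≈0

    module _ (πregular : ∀ x → StronglyπRegular x) where

      exponent : Carrier → ℕ
      exponent y = proj₁ (πregular y)

      -- 1 + y * z is 0 if y ≉ 0 and 1 if y ≈ 0, so 1 - allZeroIndicator ys is a nonzero element annihilated by every
      -- s annihilating ys, even though no nonzero entry of ys can be exhibited.
      zeroIndicator : Carrier → Carrier
      zeroIndicator y = 1# + y * proj₁ (proj₂ (πregular y))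

      allZeroIndicator : List Carrier → Carrier
      allZeroIndicator = foldr (λ y q → zeroIndicator y * q) 1#

      pow*zeroIndicator≈0 : ∀ y → y ^ exponent y * zeroIndicator y ≈ 0#
      pow*zeroIndicator≈0 y = proj₂ (proj₂ (πregular y))

      *zeroIndicator≈ : ∀ {s y} → s * y ≈ 0# → s * zeroIndicator y ≈ s
      *zeroIndicator≈ {s} {y} sy≈0 = begin
        s * (1# + y * z)     ≈⟨ solve 3 (λ s y z → s :* (con 1 :+ y :* z) := s :+ s :* y :* z) refl s y z ⟩
        s + s * y * z        ≈⟨ +-congˡ (*-congʳ sy≈0) ⟩
        s + 0# * z           ≈⟨ +-congˡ (zeroˡ z) ⟩
        s + 0#               ≈⟨ +-identityʳ s ⟩
        s                    ∎
        where z = proj₁ (proj₂ (πregular y))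

      *allZeroIndicator≈ : ∀ {s ys} → All (λ y → s * y ≈ 0#) ys → s * allZeroIndicator ys ≈ s
      *allZeroIndicator≈ {s} [] = *-identityʳ s
      *allZeroIndicator≈ {s} {y ∷ ys} (sy≈0 ∷ sys≈0) = begin
        s * (zeroIndicator y * allZeroIndicator ys) ≈⟨ *-assoc s _ _ ⟨
        s * zeroIndicator y * allZeroIndicator ys   ≈⟨ *-congʳ (*zeroIndicator≈ sy≈0) ⟩
        s * allZeroIndicator ys                     ≈⟨ *allZeroIndicator≈ sys≈0 ⟩
        s                                           ∎

      pow*allZeroIndicator≈0 : ∀ ys → All (λ y → y ^ exponent y * allZeroIndicator ys ≈ 0#) ys
      pow*allZeroIndicator≈0 []       = []
      pow*allZeroIndicator≈0 (y ∷ ys) = head ∷ All.map tail (pow*allZeroIndicator≈0 ys)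
        where
        head : y ^ exponent y * (zeroIndicator y * allZeroIndicator ys) ≈ 0#
        head = begin
          y ^ exponent y * (zeroIndicator y * allZeroIndicator ys) ≈⟨ *-assoc _ _ _ ⟨
          y ^ exponent y * zeroIndicator y * allZeroIndicator ys   ≈⟨ *-congʳ (pow*zeroIndicator≈0 y) ⟩
          0# * allZeroIndicator ys                                 ≈⟨ zeroˡ _ ⟩
          0#                                                       ∎
        tail : ∀ {w} → w ^ exponent w * allZeroIndicator ys ≈ 0# →
               w ^ exponent w * (zeroIndicator y * allZeroIndicator ys) ≈ 0#
        tail {w} wᵐQ≈0 = begin
          w ^ exponent w * (zeroIndicator y * allZeroIndicator ys) ≈⟨ x∙yz≈y∙xz _ _ _ ⟩
          zeroIndicator y * (w ^ exponent w * allZeroIndicator ys) ≈⟨ *-congˡ wᵐQ≈0 ⟩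
          zeroIndicator y * 0#                                     ≈⟨ zeroʳ _ ⟩
          0#                                                       ∎

      allZeroIndicator≈1⇒¬¬allZero : ∀ ys → allZeroIndicator ys ≈ 1# → ¬ ¬ All (_≈ 0#) ys
      allZeroIndicator≈1⇒¬¬allZero ys Q≈1 = All-¬¬ (All.map yᵐ≈0⇒¬¬y≈0 (pow*allZeroIndicator≈0 ys))
        where
        yᵐ≈0⇒¬¬y≈0 : ∀ {y} → y ^ exponent y * allZeroIndicator ys ≈ 0# → ¬ ¬ y ≈ 0#
        yᵐ≈0⇒¬¬y≈0 {y} yᵐQ≈0 = pow≈0⇒¬¬≈0 (exponent y)
          (trans (sym (trans (*-congˡ Q≈1) (*-identityʳ _))) yᵐQ≈0)

      annihilator≈0 : ∀ {s} ys → All (λ y → s * y ≈ 0#) ys → ¬ All (_≈ 0#) ys → s ≈ 0#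
      annihilator≈0 {s} ys sys≈0 ys≉0 = begin
        s            ≈⟨ *-identityʳ s ⟨
        s * 1#       ≈⟨ *-congˡ uw≈1 ⟨
        s * (u * w)  ≈⟨ *-assoc s u w ⟨
        s * u * w    ≈⟨ *-congʳ su≈0 ⟩
        0# * w       ≈⟨ zeroˡ w ⟩
        0#           ∎
        where
        Q = allZeroIndicator ys
        u = 1# - Q

        u≉0 : ¬ u ≈ 0#
        u≉0 u≈0 = allZeroIndicator≈1⇒¬¬allZero ys (sym (x∙y⁻¹≈ε⇒x≈y 1# Q u≈0)) ys≉0

        w = proj₁ (inverse u u≉0)
        uw≈1 = proj₂ (inverse u u≉0)

        su≈0 : s * u ≈ 0#
        su≈0 = trans (x[y-z]≈xy-xz s 1# Q)
                     (x≈y⇒x∙y⁻¹≈ε (trans (*-identityʳ s) (sym (*allZeroIndicator≈ sys≈0))))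

module Matrices {c ℓ} (K : CommutativeRing c ℓ) where
  open CommutativeRing K
  open M2
  open Scalars K
  open import Algebra.Properties.Ring ring
    using (-‿distribˡ-*; -‿injective; -0#≈0#; -‿+-comm; x[y-z]≈xy-xz; x∙y⁻¹≈ε⇒x≈y; x≈y⇒x∙y⁻¹≈ε)
  open import Algebra.Solver.Ring.NaturalCoefficients.Default commutativeSemiring

  infix  4 _≈ᴹ_
  infixl 6 _+ᴹ_
  infixl 7 _*ᴹ_

  _≈ᴹ_ : M2 K → M2 K → Set ℓ
  _≈ᴹ_ = _≈M_ K

  _+ᴹ_ : M2 K → M2 K → M2 K
  _+ᴹ_ = _+M_ K

  _*ᴹ_ : M2 K → M2 K → M2 K
  _*ᴹ_ = _*M_ K

  ≈ᴹ-setoid : Setoid c ℓ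
  ≈ᴹ-setoid = record
    { Carrier       = M2 K
    ; _≈_           = _≈ᴹ_
    ; isEquivalence = record
      { refl  = refl , refl , refl , refl
      ; sym   = λ (p , q , r , s) → sym p , sym q , sym r , sym s
      ; trans = λ (p , q , r , s) (p′ , q′ , r′ , s′) → trans p p′ , trans q q′ , trans r r′ , trans s s′
      }
    }

  open Setoid ≈ᴹ-setoid public using () renaming (refl to ≈ᴹ-refl; sym to ≈ᴹ-sym; trans to ≈ᴹ-trans)

  +ᴹ-commutativeMonoid : CommutativeMonoid c ℓ
  +ᴹ-commutativeMonoid = record
    { Carrier             = M2 K
    ; _≈_                 = _≈ᴹ_
    ; _∙_                 = _+ᴹ_
    ; ε                   = 0M K
    ; isCommutativeMonoid = record
      { isMonoid = record
        { isSemigroup = record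
          { isMagma = record
            { isEquivalence = Setoid.isEquivalence ≈ᴹ-setoid
            ; ∙-cong        = λ (p , q , r , s) (p′ , q′ , r′ , s′) →
                                +-cong p p′ , +-cong q q′ , +-cong r r′ , +-cong s s′
            }
          ; assoc = λ _ _ _ → +-assoc _ _ _ , +-assoc _ _ _ , +-assoc _ _ _ , +-assoc _ _ _
          }
        ; identity = (λ _ → +-identityˡ _ , +-identityˡ _ , +-identityˡ _ , +-identityˡ _)
                   , (λ _ → +-identityʳ _ , +-identityʳ _ , +-identityʳ _ , +-identityʳ _)
        }
      ; comm = λ _ _ → +-comm _ _ , +-comm _ _ , +-comm _ _ , +-comm _ _
      }
    }

  sumM≡foldr : ∀ As → sumM K As ≡ foldr _+ᴹ_ (0M K) As
  sumM≡foldr []       = ≡.refl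
  sumM≡foldr (A ∷ As) = ≡.cong (A +ᴹ_) (sumM≡foldr As)

  sumM-map-homo : (f : M2 K → M2 K) → f (0M K) ≈ᴹ 0M K → (∀ A B → f (A +ᴹ B) ≈ᴹ f A +ᴹ f B) →
                  ∀ As → sumM K (map f As) ≈ᴹ f (sumM K As)
  sumM-map-homo f f-0 f-+ As rewrite sumM≡foldr (map f As) | sumM≡foldr As =
    foldr-map-homo (CommutativeMonoid.monoid +ᴹ-commutativeMonoid) f f-0 f-+ As

  sumM-map-permutation : (f : M2 K → M2 K) → (∀ {A B} → f A ≈ᴹ f B → A ≈ᴹ B) →
                         ∀ {As} → AllPairs (λ A B → ¬ A ≈ᴹ B) As → (∀ {A} → _∈M_ K A As → _∈M_ K (f A) As) →
                         sumM K (map f As) ≈ᴹ sumM K As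
  sumM-map-permutation f f-injective {As} As! f-closed rewrite sumM≡foldr (map f As) | sumM≡foldr As =
    foldr-map-permutation +ᴹ-commutativeMonoid f f-injective As! f-closed

  invSL-0ᴹ : invSL K (0M K) ≈ᴹ 0M K
  invSL-0ᴹ = refl , -0#≈0# , -0#≈0# , refl

  invSL-+ᴹ : ∀ A B → invSL K (A +ᴹ B) ≈ᴹ invSL K A +ᴹ invSL K B
  invSL-+ᴹ A B = refl , sym (-‿+-comm _ _) , sym (-‿+-comm _ _) , refl

  invSL-injective : ∀ {A B} → invSL K A ≈ᴹ invSL K B → A ≈ᴹ B
  invSL-injective (p , q , r , s) = s , -‿injective q , -‿injective r , p

  *ᴹ-congˡ : ∀ G {A B} → A ≈ᴹ B → G *ᴹ A ≈ᴹ G *ᴹ B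
  *ᴹ-congˡ G (p , q , r , s) =
    +-cong (*-congˡ p) (*-congˡ r) , +-cong (*-congˡ q) (*-congˡ s) ,
    +-cong (*-congˡ p) (*-congˡ r) , +-cong (*-congˡ q) (*-congˡ s)

  *ᴹ-congʳ : ∀ G {A B} → A ≈ᴹ B → A *ᴹ G ≈ᴹ B *ᴹ G
  *ᴹ-congʳ G (p , q , r , s) =
    +-cong (*-congʳ p) (*-congʳ q) , +-cong (*-congʳ p) (*-congʳ q) ,
    +-cong (*-congʳ r) (*-congʳ s) , +-cong (*-congʳ r) (*-congʳ s)

  *ᴹ-zeroʳ : ∀ G → G *ᴹ 0M K ≈ᴹ 0M K
  *ᴹ-zeroʳ G = entry _ _ , entry _ _ , entry _ _ , entry _ _
    where
    entry : ∀ x y → x * 0# + y * 0# ≈ 0#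
    entry = solve 2 (λ x y → x :* con 0 :+ y :* con 0 := con 0) refl

  *ᴹ-distribˡ-+ᴹ : ∀ G A B → G *ᴹ (A +ᴹ B) ≈ᴹ G *ᴹ A +ᴹ G *ᴹ B
  *ᴹ-distribˡ-+ᴹ G A B = entry _ _ _ _ _ _ , entry _ _ _ _ _ _ , entry _ _ _ _ _ _ , entry _ _ _ _ _ _
    where
    entry : ∀ x y a b a′ b′ → x * (a + a′) + y * (b + b′) ≈ (x * a + y * b) + (x * a′ + y * b′)
    entry = solve 6 (λ x y a b a′ b′ →
      x :* (a :+ a′) :+ y :* (b :+ b′) := (x :* a :+ y :* b) :+ (x :* a′ :+ y :* b′)) refl

  *ᴹ-assoc : ∀ A B C → (A *ᴹ B) *ᴹ C ≈ᴹ A *ᴹ (B *ᴹ C)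
  *ᴹ-assoc A B C = entry _ _ _ _ _ _ _ _ , entry _ _ _ _ _ _ _ _ , entry _ _ _ _ _ _ _ _ , entry _ _ _ _ _ _ _ _
    where
    entry : ∀ x₁ x₂ y₁₁ y₁₂ y₂₁ y₂₂ z₁ z₂ →
            (x₁ * y₁₁ + x₂ * y₂₁) * z₁ + (x₁ * y₁₂ + x₂ * y₂₂) * z₂ ≈
            x₁ * (y₁₁ * z₁ + y₁₂ * z₂) + x₂ * (y₂₁ * z₁ + y₂₂ * z₂)
    entry = solve 8 (λ x₁ x₂ y₁₁ y₁₂ y₂₁ y₂₂ z₁ z₂ →
      (x₁ :* y₁₁ :+ x₂ :* y₂₁) :* z₁ :+ (x₁ :* y₁₂ :+ x₂ :* y₂₂) :* z₂ :=
      x₁ :* (y₁₁ :* z₁ :+ y₁₂ :* z₂) :+ x₂ :* (y₂₁ :* z₁ :+ y₂₂ :* z₂)) refl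

  *ᴹ-identityˡ : ∀ A → 1M K *ᴹ A ≈ᴹ A
  *ᴹ-identityˡ A = first _ _ , first _ _ , second _ _ , second _ _
    where
    first : ∀ x y → 1# * x + 0# * y ≈ x
    first = solve 2 (λ x y → con 1 :* x :+ con 0 :* y := x) refl
    second : ∀ x y → 0# * x + 1# * y ≈ y
    second = solve 2 (λ x y → con 0 :* x :+ con 1 :* y := y) refl

  invSL-inverseˡ : ∀ {G} → det K G ≈ 1# → invSL K G *ᴹ G ≈ᴹ 1M K
  invSL-inverseˡ {mat a b c′ d} det≈1 =
    trans (+-cong (*-comm d a) (trans (-x*y≈-[y*x] b c′) (-‿cong (*-comm c′ b)))) det≈1 ,
    trans (+-congˡ (-x*y≈-[y*x] b d)) (-‿inverseʳ _) ,
    trans (+-congʳ (-x*y≈-[y*x] c′ a)) (-‿inverseˡ _) ,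
    trans (+-comm _ _) (trans (+-congˡ (-x*y≈-[y*x] c′ b)) det≈1)
    where
    -x*y≈-[y*x] : ∀ x y → - x * y ≈ - (y * x)
    -x*y≈-[y*x] x y = trans (sym (-‿distribˡ-* x y)) (-‿cong (*-comm x y))

  *ᴹ-cancelˡ : ∀ {G} → det K G ≈ 1# → ∀ {A B} → G *ᴹ A ≈ᴹ G *ᴹ B → A ≈ᴹ B
  *ᴹ-cancelˡ {G} det≈1 {A} {B} GA≈GB = begin
    A                      ≈⟨ *ᴹ-identityˡ A ⟨
    1M K *ᴹ A              ≈⟨ *ᴹ-congʳ _ (invSL-inverseˡ det≈1) ⟨
    invSL K G *ᴹ G *ᴹ A    ≈⟨ *ᴹ-assoc _ G A ⟩
    invSL K G *ᴹ (G *ᴹ A)  ≈⟨ *ᴹ-congˡ _ GA≈GB ⟩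
    invSL K G *ᴹ (G *ᴹ B)  ≈⟨ *ᴹ-assoc _ G B ⟨
    invSL K G *ᴹ G *ᴹ B    ≈⟨ *ᴹ-congʳ _ (invSL-inverseˡ det≈1) ⟩
    1M K *ᴹ B              ≈⟨ *ᴹ-identityˡ B ⟩
    B                      ∎
    where open import Relation.Binary.Reasoning.Setoid ≈ᴹ-setoid

  scalarM : Carrier → M2 K
  scalarM s = mat s 0# 0# s

  scale : Carrier → M2 K → M2 K
  scale s A = mat (s * e11 A) (s * e12 A) (s * e21 A) (s * e22 A)

  *ᴹ-scalarM : ∀ G s → G *ᴹ scalarM s ≈ᴹ scale s G
  *ᴹ-scalarM G s = first _ _ , second _ _ , first _ _ , second _ _
    where
    first : ∀ x y → x * s + y * 0# ≈ s * x
    first x y = solve 3 (λ x y s → x :* s :+ y :* con 0 := s :* x) refl x y s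
    second : ∀ x y → x * 0# + y * s ≈ s * y
    second x y = solve 3 (λ x y s → x :* con 0 :+ y :* s := s :* y) refl x y s

  invSL-fixed⇒scalar : (∀ {x} → - x ≈ x → x ≈ 0#) → ∀ {S} → invSL K S ≈ᴹ S → S ≈ᴹ scalarM (e11 S)
  invSL-fixed⇒scalar -x≈x⇒x≈0 (e₂₂≈e₁₁ , -e₁₂≈e₁₂ , -e₂₁≈e₂₁ , _) =
    refl , -x≈x⇒x≈0 -e₁₂≈e₁₂ , -x≈x⇒x≈0 -e₂₁≈e₂₁ , e₂₂≈e₁₁

  module Subgroup {As} (G : IsFiniteSubgroupSL2 K As) where
    open IsFiniteSubgroupSL2 G

    invSL-fixes-sumM : invSL K (sumM K As) ≈ᴹ sumM K As
    invSL-fixes-sumM = ≈ᴹ-trans (≈ᴹ-sym (sumM-map-homo (invSL K) invSL-0ᴹ invSL-+ᴹ As))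
                                (sumM-map-permutation (invSL K) invSL-injective distinct (invClosed _))

    *ᴹ-fixes-sumM : ∀ {g} → det K g ≈ 1# → _∈M_ K g As → g *ᴹ sumM K As ≈ᴹ sumM K As
    *ᴹ-fixes-sumM {g} det≈1 g∈As =
      ≈ᴹ-trans (≈ᴹ-sym (sumM-map-homo (g *ᴹ_) (*ᴹ-zeroʳ g) (*ᴹ-distribˡ-+ᴹ g) As))
               (sumM-map-permutation (g *ᴹ_) (*ᴹ-cancelˡ det≈1) distinct (mulClosed g _ g∈As))

    sumM≈sI⇒sg≈sI : ∀ {s g} → sumM K As ≈ᴹ scalarM s → det K g ≈ 1# → _∈M_ K g As →
                    scale s g ≈ᴹ scalarM s
    sumM≈sI⇒sg≈sI {s} {g} S≈sI det≈1 g∈As = begin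
      scale s g        ≈⟨ *ᴹ-scalarM g s ⟨
      g *ᴹ scalarM s   ≈⟨ *ᴹ-congˡ g S≈sI ⟨
      g *ᴹ sumM K As   ≈⟨ *ᴹ-fixes-sumM det≈1 g∈As ⟩
      sumM K As        ≈⟨ S≈sI ⟩
      scalarM s        ∎
      where open import Relation.Binary.Reasoning.Setoid ≈ᴹ-setoid

  module _ (K-field : IsField K) (πregular : ∀ x → StronglyπRegular x) where

    scale-≈ᴹ⇒≈0 : ∀ {s A B} → scale s A ≈ᴹ scale s B → ¬ A ≈ᴹ B → s ≈ 0#
    scale-≈ᴹ⇒≈0 {s} {A} {B} (p , q , r , t) A≉B =
      annihilator≈0 K-field πregular _ (difference p ∷ difference q ∷ difference r ∷ difference t ∷ []) A-B≉0
      where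
      difference : ∀ {x y} → s * x ≈ s * y → s * (x - y) ≈ 0#
      difference sx≈sy = trans (x[y-z]≈xy-xz _ _ _) (x≈y⇒x∙y⁻¹≈ε sx≈sy)

      A-B≉0 : ¬ All (_≈ 0#) (e11 A - e11 B ∷ e12 A - e12 B ∷ e21 A - e21 B ∷ e22 A - e22 B ∷ [])
      A-B≉0 (p ∷ q ∷ r ∷ t ∷ []) =
        A≉B (x∙y⁻¹≈ε⇒x≈y _ _ p , x∙y⁻¹≈ε⇒x≈y _ _ q ,
             x∙y⁻¹≈ε⇒x≈y _ _ r , x∙y⁻¹≈ε⇒x≈y _ _ t)

lemma3p1 : {c ℓ : Level} (p : ℕ) → Prime p → p ≢ 2 →
    (K : CommutativeRing c ℓ) → IsAlgClosureOfFp K p →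
    (A : List (M2 K)) → IsFiniteSubgroupSL2 K A → length A ≢ 1 →
    _≈M_ K (sumM K A) (0M K)
lemma3p1 p p-prime p≢2 K K-closure []       _ _     = Matrices.≈ᴹ-refl K
lemma3p1 p p-prime p≢2 K K-closure (_ ∷ []) _ |A|≢1 = contradiction ≡.refl |A|≢1
lemma3p1 p p-prime p≢2 K K-closure As@(g ∷ h ∷ _) G _ = begin
  S           ≈⟨ S≈sI ⟩
  scalarM s   ≈⟨ s≈0 , refl , refl , s≈0 ⟩
  0M K        ∎
  where
  open CommutativeRing K
  open IsAlgClosureOfFp K-closure
  open Scalars K
  open Characteristic {p} char
  open Matrices K
  open IsFiniteSubgroupSL2 G
  open Subgroup G
  open import Relation.Binary.Reasoning.Setoid ≈ᴹ-setoid

  S = sumM K As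
  s = M2.e11 S

  S≈sI : S ≈ᴹ scalarM s
  S≈sI = invSL-fixed⇒scalar (-x≈x⇒x≈0 p-prime p≢2) invSL-fixes-sumM

  sg≈sh : scale s g ≈ᴹ scale s h
  sg≈sh = ≈ᴹ-trans (sumM≈sI⇒sg≈sI S≈sI (All.head inSL2) (here ≈ᴹ-refl))
                   (≈ᴹ-sym (sumM≈sI⇒sg≈sI S≈sI (All.head (All.tail inSL2)) (there (here ≈ᴹ-refl))))

  s≈0 : s ≈ 0#
  s≈0 = scale-≈ᴹ⇒≈0 isField (algebraic⇒stronglyπRegular p-prime algebraic) sg≈sh
                    (All.head (AllPairs.head distinct))
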